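{- Let $r\ge 3$ be an integer and $0<\varepsilon<1$. Then for every graph $G$ of order $n$ with at least $(1-\varepsilon)\binom{n}{2}$ edges we have $G\to(P_k)_r$, where $k=(1-\varepsilon)n/r$.
   Context: $P_k$ is the path on $k$ vertices. $G\to(P_k)_r$ means every colouring of the edges of $G$ with $r$ colours yields a monochromatic copy of $P_k$.
   Formalization: The parameter ε ranges over the rationals. -}

module Defs where

open import Data.Nat using (ℕ; zero; suc; _+_; _<ᵇ_)
open import Data.Bool using (Bool; true; false; _∧_; T; T?)
open import Data.Fin using (Fin; toℕ)
open import Data.List using (List; length; filter; concatMap; map; allFin)
open import Data.Product using (Σ; _×_; _,_)
open import Data.Integer using (ℤ; +_; ∣_∣)
open import Data.Rational using (ℚ; _/_; _*_; _-_; 0ℚ; 1ℚ; ceiling)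
open import Relation.Binary.PropositionalEquality using (_≡_)

record Graph (n : ℕ) : Set where
  field
    adj   : Fin n → Fin n → Bool
    sym   : ∀ i j → adj i j ≡ adj j i
    irrefl : ∀ i → adj i i ≡ false
open Graph public

edgeCount : ∀ {n} → Graph n → ℕ
edgeCount {n} G =
  length (filter (λ p → T? (edgeᵇ p))
                 (concatMap (λ i → map (λ j → (i , j)) (allFin n)) (allFin n)))
  where
  edgeᵇ : Fin n × Fin n → Bool
  edgeᵇ (i , j) = (toℕ i <ᵇ toℕ j) ∧ adj G i j

choose2 : ℕ → ℕ
choose2 zero = zero
choose2 (suc n) = n + choose2 n

record EdgeColouring {n} (G : Graph n) (r : ℕ) : Set where
  field
    colour : (i j : Fin n) → T (adj G i j) → Fin r
    colour-sym : ∀ i j (e : T (adj G i j)) (e' : T (adj G j i)) →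
                 colour i j e ≡ colour j i e'
open EdgeColouring public

record MonoPath {n} {G : Graph n} {r : ℕ} (c : EdgeColouring G r) (k : ℕ) : Set where
  field
    γ     : Fin r
    v     : Fin k → Fin n
    inj   : ∀ a b → v a ≡ v b → a ≡ b
    edge  : ∀ (a : Fin k) (b : Fin k) → suc (toℕ a) ≡ toℕ b →
            Σ (T (adj G (v a) (v b))) λ e → colour c (v a) (v b) e ≡ γ

_⟶P[_]_ : ∀ {n} → Graph n → ℕ → ℕ → Set
G ⟶P[ k ] r = (c : EdgeColouring G r) → MonoPath c k

ℕtoℚ : ℕ → ℚ
ℕtoℚ m = + m / 1

-- 1/r as a rational (only used for r ≥ 3; the value at 0 is irrelevant).
inv : ℕ → ℚ
inv zero = 0ℚ
inv (suc r) = + 1 / suc r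

-- k = (1 - ε) n / r, rounded up to an integer number of vertices
-- (a path on at least (1-ε)n/r vertices).
pathOrder : ℚ → ℕ → ℕ → ℕ
pathOrder ε n r = ∣ ceiling ((1ℚ - ε) * ℕtoℚ n * inv r) ∣

module Submission where

-- Erdős–Gallai: a graph on n vertices without a path on j + 2 vertices has at most n j / 2 edges.
-- We split vertex sets off S one at a time, each carrying at most j arcs per removed vertex.
-- If some vertex has degree at most j / 2 it is such a set. Otherwise take a longest path P;
-- it has at most j + 1 vertices and all neighbours of its ends lie on P, so the two end degrees
-- sum to at least |P| and the pigeonhole principle gives chords x b, a y with a b an edge of P.
-- Pósa's rotation turns P into a cycle through V(P), and by maximality of P no edge leaves V(P),
-- so V(P) is such a set.
--
-- For the corollary let k = j + 2 be the path order. If no colour class contains P_k, then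
-- 2|E| ≤ r n j by Erdős–Gallai in each class. But k = ⌈(1 - ε) n / r⌉ gives (j + 1) r < (1 - ε) n,
-- hence j + 1 < n and r n j ≤ (j + 1) r (n - 1) < (1 - ε) n (n - 1) ≤ 2|E|.

open import Data.Nat using (ℕ)
open import Defs using (Graph)

module Sums where

  open import Data.Bool using (Bool; true; false; T; _∧_; _∨_; not)
  open import Data.Empty using (⊥)
  open import Data.Fin using (Fin; zero; suc)
  open import Data.Fin.Properties using (_≟_)
  open import Data.Nat using (zero; suc; _+_; _*_; _≤_; z≤n)
  open import Data.Nat.Properties using (≤-refl; ≤-trans; +-identityʳ; +-mono-≤; m≤m+n; m≤n+m; +-*-semiring)
  open import Data.Unit using (tt)
  open import Relation.Binary.PropositionalEquality using (_≡_; refl; sym; trans; cong)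
  open import Relation.Nullary using (does)
  open import Algebra.Properties.Semiring.Sum +-*-semiring public
    using (sum; sum-syntax; sum-cong-≗; ∑-distrib-+; ∑-comm; *-distribʳ-sum)
  open import Algebra.Properties.Semiring.Sum +-*-semiring using (sum-replicate-zero)

  infixr 7 _⊙_

  _⊙_ : Bool → ℕ → ℕ
  true  ⊙ x = x
  false ⊙ x = 0

  𝟙 : Bool → ℕ
  𝟙 b = b ⊙ 1

  𝟙≤1 : ∀ b → 𝟙 b ≤ 1
  𝟙≤1 true  = ≤-refl
  𝟙≤1 false = z≤n

  ⊙-distribˡ-+ : ∀ b x y → b ⊙ (x + y) ≡ b ⊙ x + b ⊙ y
  ⊙-distribˡ-+ true  x y = refl
  ⊙-distribˡ-+ false x y = refl

  ⊙-comm : ∀ a b x → a ⊙ b ⊙ x ≡ b ⊙ a ⊙ x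
  ⊙-comm true  b     x = refl
  ⊙-comm false true  x = refl
  ⊙-comm false false x = refl

  ⊙-split : ∀ a c x → a ⊙ x ≡ (a ∧ c) ⊙ x + (a ∧ not c) ⊙ x
  ⊙-split true  true  x = sym (+-identityʳ x)
  ⊙-split true  false x = refl
  ⊙-split false c     x = refl

  ∨-⊙ : ∀ a b x → (T a → T b → ⊥) → (a ∨ b) ⊙ x ≡ a ⊙ x + b ⊙ x
  ∨-⊙ true  true  x ¬ab with () ← ¬ab tt tt
  ∨-⊙ true  false x _   = sym (+-identityʳ x)
  ∨-⊙ false b     x _   = refl

  ⊙-mono-≤ : ∀ {a b x y} → (T a → T b) → (T a → x ≤ y) → a ⊙ x ≤ b ⊙ y
  ⊙-mono-≤ {false}         _   _   = z≤n
  ⊙-mono-≤ {true}  {true}  _   x≤y = x≤y tt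
  ⊙-mono-≤ {true}  {false} a⇒b _   with () ← a⇒b tt

  ⊙≡𝟙* : ∀ b x → b ⊙ x ≡ 𝟙 b * x
  ⊙≡𝟙* true  x = sym (+-identityʳ x)
  ⊙≡𝟙* false x = refl

  ∑-zero : ∀ {m} {f : Fin m → ℕ} → (∀ i → f i ≡ 0) → sum f ≡ 0
  ∑-zero {m} f≗0 = trans (sum-cong-≗ f≗0) (sum-replicate-zero m)

  ∑-const : ∀ m c → ∑[ i < m ] c ≡ m * c
  ∑-const zero    c = refl
  ∑-const (suc m) c = cong (c +_) (∑-const m c)

  ∑-mono-≤ : ∀ {m} {f g : Fin m → ℕ} → (∀ i → f i ≤ g i) → sum f ≤ sum g
  ∑-mono-≤ {zero}  f≤g = z≤n
  ∑-mono-≤ {suc m} f≤g = +-mono-≤ (f≤g zero) (∑-mono-≤ (λ i → f≤g (suc i)))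

  ∑-≥-term : ∀ {m} (f : Fin m → ℕ) i → f i ≤ sum f
  ∑-≥-term f zero    = m≤m+n _ _
  ∑-≥-term f (suc i) = ≤-trans (∑-≥-term (λ j → f (suc j)) i) (m≤n+m _ (f zero))

  ⊙-∑ : ∀ {m} b (f : Fin m → ℕ) → b ⊙ sum f ≡ ∑[ i < m ] (b ⊙ f i)
  ⊙-∑     true  f = refl
  ⊙-∑ {m} false f = sym (∑-zero {m} (λ _ → refl))

  ∑-⊙-≟ : ∀ {m} (v : Fin m) (f : Fin m → ℕ) → ∑[ w < m ] (does (w ≟ v) ⊙ f w) ≡ f v
  ∑-⊙-≟ {suc m} zero    f = trans (cong (f zero +_) (∑-zero {m} (λ _ → refl))) (+-identityʳ (f zero))
  ∑-⊙-≟         (suc v) f = ∑-⊙-≟ v (λ i → f (suc i))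

  ∑-split : ∀ {m} (a c : Fin m → Bool) (f : Fin m → ℕ) →
            ∑[ i < m ] (a i ⊙ f i) ≡ ∑[ i < m ] ((a i ∧ c i) ⊙ f i) + ∑[ i < m ] ((a i ∧ not (c i)) ⊙ f i)
  ∑-split a c f = trans (sum-cong-≗ (λ i → ⊙-split (a i) (c i) (f i)))
                        (∑-distrib-+ (λ i → (a i ∧ c i) ⊙ f i) (λ i → (a i ∧ not (c i)) ⊙ f i))

module Lists where

  open import Data.Bool using (Bool; true; false; T; _∨_)
  open import Data.Bool.Properties using (T?)
  open import Data.Empty using (⊥; ⊥-elim)
  open import Data.Fin using (Fin; zero; suc)
  open import Data.Fin.Properties using (_≟_; any?)
  open import Data.List using (List; []; _∷_; _++_; [_]; _ʳ++_; length; map; lookup; filter; concatMap; tabulate)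
  open import Data.List.Membership.Propositional using (_∈_)
  open import Data.List.Membership.Propositional.Properties using (∈-lookup)
  import Data.List.Membership.DecPropositional as DecMembership
  open import Data.List.Relation.Unary.All as All using ()
  open import Data.List.Relation.Unary.All.Properties using (All¬⇒¬Any)
  open import Data.List.Relation.Unary.Any using (Any; here; there)
  open import Data.List.Relation.Unary.Unique.Propositional using (Unique; _∷_)
  open import Data.List.Relation.Binary.Permutation.Propositional using (_↭_; ↭-sym; ↭-trans; ↭⇒↭ₛ)
  open import Data.List.Relation.Binary.Permutation.Propositional.Properties using (++-comm; ++⁺ʳ; ↭-reverse)
  import Data.List.Relation.Binary.Permutation.Setoid.Properties as Setoid
  open import Data.Nat using (zero; suc; _+_; _≤_; _<_; z≤n; s≤s)
  open import Data.Nat.Properties using (≤-trans; ≤-pred; <-trans; n<1+n; +-assoc; +-suc; +-mono-≤; +-monoˡ-≤)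
  open import Data.Product using (_×_; _,_; proj₁; proj₂; ∃₂; ∃-syntax)
  open import Data.Unit using (tt)
  open import Function using (_∘_)
  open import Relation.Binary.PropositionalEquality
    using (_≡_; refl; sym; trans; cong; cong₂; subst; setoid; module ≡-Reasoning)
  open import Relation.Nullary using (Dec; yes; no; does)
  open Sums

  private
    variable
      A B : Set

  count : (A → Bool) → List A → ℕ
  count p []       = 0
  count p (x ∷ xs) = 𝟙 (p x) + count p xs

  count-++ : ∀ (p : A → Bool) xs ys → count p (xs ++ ys) ≡ count p xs + count p ys
  count-++ p []       ys = refl
  count-++ p (x ∷ xs) ys = trans (cong (𝟙 (p x) +_) (count-++ p xs ys)) (sym (+-assoc (𝟙 (p x)) _ _))

  count-map : ∀ p (f : B → A) xs → count p (map f xs) ≡ count (p ∘ f) xs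
  count-map p f []       = refl
  count-map p f (x ∷ xs) = cong (𝟙 (p (f x)) +_) (count-map p f xs)

  count-≤-length : ∀ (p : A → Bool) xs → count p xs ≤ length xs
  count-≤-length p []       = z≤n
  count-≤-length p (x ∷ xs) = +-mono-≤ (𝟙≤1 (p x)) (count-≤-length p xs)

  count-<-length : ∀ (p : A → Bool) {x xs} → x ∈ xs → p x ≡ false → count p xs < length xs
  count-<-length p {xs = y ∷ ys} (here refl)  px≡false rewrite px≡false = s≤s (count-≤-length p ys)
  count-<-length p {xs = y ∷ ys} (there x∈ys) px≡false =
    s≤s (≤-trans (+-monoˡ-≤ (count p ys) (𝟙≤1 (p y))) (count-<-length p x∈ys px≡false))

  pigeonhole : ∀ (p q : A → Bool) xs → length xs < count p xs + count q xs →
               Any (λ x → T (p x) × T (q x)) xs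
  pigeonhole p q (x ∷ xs) |xs|< with p x in px | q x in qx
  ... | true  | true  = here (subst T (sym px) tt , subst T (sym qx) tt)
  ... | true  | false = there (pigeonhole p q xs (≤-pred |xs|<))
  ... | false | true  = there (pigeonhole p q xs (≤-pred (subst (suc (length xs) <_) (+-suc _ _) |xs|<)))
  ... | false | false = there (pigeonhole p q xs (<-trans (n<1+n _) |xs|<))

  length-filter : ∀ (p : A → Bool) xs → length (filter (T? ∘ p) xs) ≡ count p xs
  length-filter p []       = refl
  length-filter p (x ∷ xs) with p x
  ... | true  = cong suc (length-filter p xs)
  ... | false = length-filter p xs

  count-tabulate : ∀ {m} (p : A → Bool) (f : Fin m → A) → count p (tabulate f) ≡ ∑[ i < m ] 𝟙 (p (f i))
  count-tabulate {m = zero}  p f = refl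
  count-tabulate {m = suc m} p f = cong (𝟙 (p (f zero)) +_) (count-tabulate p (f ∘ suc))

  count-concatMap-tabulate : ∀ {m} (p : B → Bool) (F : A → List B) (g : Fin m → A) →
                             count p (concatMap F (tabulate g)) ≡ ∑[ i < m ] count p (F (g i))
  count-concatMap-tabulate {m = zero}  p F g = refl
  count-concatMap-tabulate {m = suc m} p F g =
    trans (count-++ p (F (g zero)) (concatMap F (tabulate (g ∘ suc))))
          (cong (count p (F (g zero)) +_) (count-concatMap-tabulate p F (g ∘ suc)))

  lastFrom : A → List A → A
  lastFrom x []       = x
  lastFrom x (y ∷ ys) = lastFrom y ys

  lastFrom-∈ : ∀ (x : A) xs → lastFrom x xs ∈ x ∷ xs
  lastFrom-∈ x []       = here refl
  lastFrom-∈ x (y ∷ ys) = there (lastFrom-∈ y ys)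

  lastFrom-++ : ∀ (x : A) as bs → lastFrom x (as ++ bs) ≡ lastFrom (lastFrom x as) bs
  lastFrom-++ x []       bs = refl
  lastFrom-++ x (a ∷ as) bs = lastFrom-++ a as bs

  lastFrom-ʳ++ : ∀ (u x : A) as acc → lastFrom u (as ʳ++ x ∷ acc) ≡ lastFrom x acc
  lastFrom-ʳ++ u x []       acc = refl
  lastFrom-ʳ++ u x (a ∷ as) acc = lastFrom-ʳ++ u a as (x ∷ acc)

  pairs : A → List A → List (A × A)
  pairs x []       = []
  pairs x (y ∷ ys) = (x , y) ∷ pairs y ys

  length-pairs : ∀ (x : A) xs → length (pairs x xs) ≡ length xs
  length-pairs x []       = refl
  length-pairs x (y ∷ ys) = cong suc (length-pairs y ys)

  map-proj₂-pairs : ∀ (x : A) xs → map proj₂ (pairs x xs) ≡ xs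
  map-proj₂-pairs x []       = refl
  map-proj₂-pairs x (y ∷ ys) = cong (y ∷_) (map-proj₂-pairs y ys)

  map-proj₁-pairs : ∀ (x : A) xs → map proj₁ (pairs x xs) ++ [ lastFrom x xs ] ≡ x ∷ xs
  map-proj₁-pairs x []       = refl
  map-proj₁-pairs x (y ∷ ys) = cong (x ∷_) (map-proj₁-pairs y ys)

  ∈-pairs⁻ : ∀ {a b x : A} xs → (a , b) ∈ pairs x xs →
             ∃₂ λ as bs → xs ≡ as ++ b ∷ bs × a ≡ lastFrom x as
  ∈-pairs⁻ (y ∷ ys) (here refl) = [] , ys , refl , refl
  ∈-pairs⁻ (y ∷ ys) (there ab∈) with ∈-pairs⁻ ys ab∈
  ... | as , bs , refl , a≡ = y ∷ as , bs , refl , a≡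

  ↭-rotate-segment : ∀ (x : A) as b bs → b ∷ bs ++ as ʳ++ [ x ] ↭ x ∷ as ++ b ∷ bs
  ↭-rotate-segment x as b bs = ↭-trans (++-comm (b ∷ bs) (as ʳ++ [ x ])) (++⁺ʳ (b ∷ bs) (↭-reverse (x ∷ as)))

  unique-resp-↭ : ∀ {xs ys : List A} → xs ↭ ys → Unique ys → Unique xs
  unique-resp-↭ {A} xs↭ys = Setoid.Unique-resp-↭ (setoid A) (↭⇒↭ₛ (↭-sym xs↭ys))

  lookup-injective : ∀ {xs : List A} → Unique xs → ∀ i j → lookup xs i ≡ lookup xs j → i ≡ j
  lookup-injective {xs = x ∷ xs} _          zero    zero    _  = refl
  lookup-injective {xs = x ∷ xs} (x∉ ∷ _)   zero    (suc j) x≡ = ⊥-elim (All.lookup x∉ (∈-lookup j) x≡)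
  lookup-injective {xs = x ∷ xs} (x∉ ∷ _)   (suc i) zero    ≡x = ⊥-elim (All.lookup x∉ (∈-lookup i) (sym ≡x))
  lookup-injective {xs = x ∷ xs} (_ ∷ uniq) (suc i) (suc j) eq = cong suc (lookup-injective uniq i j eq)

  ∃-list? : ∀ {m} (P : List (Fin m) → Set) → (∀ xs → Dec (P xs)) →
            ∀ t → Dec (∃[ xs ] length xs ≡ t × P xs)
  ∃-list? P P? zero with P? []
  ... | yes p = yes ([] , refl , p)
  ... | no ¬p = no λ { ([] , _ , p) → ¬p p }
  ∃-list? P P? (suc t) with any? (λ x → ∃-list? (P ∘ (x ∷_)) (P? ∘ (x ∷_)) t)
  ... | yes (x , xs , refl , p) = yes (x ∷ xs , refl , p)
  ... | no ¬p                   = no λ { (x ∷ xs , refl , p) → ¬p (x , xs , refl , p) }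

  module _ {m : ℕ} where

    open DecMembership (_≟_ {m}) using (_∈?_)

    ∑-count : ∀ (p : Fin m → Bool) xs → Unique xs → ∑[ w < m ] (does (w ∈? xs) ⊙ 𝟙 (p w)) ≡ count p xs
    ∑-count p []       _              = ∑-zero {m} (λ _ → refl)
    ∑-count p (x ∷ xs) (x∉xs ∷ uniq) = begin
      ∑[ w < m ] ((does (w ≟ x) ∨ does (w ∈? xs)) ⊙ 𝟙 (p w))
        ≡⟨ sum-cong-≗ (λ w → ∨-⊙ (does (w ≟ x)) (does (w ∈? xs)) (𝟙 (p w)) (disjoint w)) ⟩
      ∑[ w < m ] (does (w ≟ x) ⊙ 𝟙 (p w) + does (w ∈? xs) ⊙ 𝟙 (p w))
        ≡⟨ ∑-distrib-+ (λ w → does (w ≟ x) ⊙ 𝟙 (p w)) (λ w → does (w ∈? xs) ⊙ 𝟙 (p w)) ⟩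
      ∑[ w < m ] (does (w ≟ x) ⊙ 𝟙 (p w)) + ∑[ w < m ] (does (w ∈? xs) ⊙ 𝟙 (p w))
        ≡⟨ cong₂ _+_ (∑-⊙-≟ x (𝟙 ∘ p)) (∑-count p xs uniq) ⟩
      𝟙 (p x) + count p xs ∎
      where
      open ≡-Reasoning
      disjoint : ∀ w → T (does (w ≟ x)) → T (does (w ∈? xs)) → ⊥
      disjoint w _ _ with w ≟ x | w ∈? xs
      ... | yes refl | yes x∈xs = All¬⇒¬Any x∉xs x∈xs

module Walks {A : Set} (_~_ : A → A → Set) (~-sym : ∀ {u v} → u ~ v → v ~ u) where

  open import Data.Fin using (zero; suc; toℕ)
  open import Data.Nat.Properties using (suc-injective)
  open import Data.List using (List; []; _∷_; _++_; [_]; _ʳ++_; lookup)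
  open import Data.List.Membership.Propositional using (_∈_)
  open import Data.List.Membership.Propositional.Properties using (∈-∃++)
  open import Data.List.Relation.Binary.Permutation.Propositional using (_↭_; ↭-refl)
  open import Data.List.Relation.Binary.Permutation.Propositional.Properties using (++-comm)
  open import Data.Nat using (suc)
  open import Data.Product using (_×_; _,_; proj₁; proj₂; ∃-syntax)
  open import Data.Unit using (⊤; tt)
  open import Relation.Binary.PropositionalEquality using (_≡_; refl; sym; trans; subst)
  open Lists

  WalkFrom : A → List A → Set
  WalkFrom x []       = ⊤
  WalkFrom x (y ∷ ys) = x ~ y × WalkFrom y ys

  Walk : List A → Set
  Walk []       = ⊤
  Walk (x ∷ xs) = WalkFrom x xs

  Cycle : A → List A → Set
  Cycle c cs = WalkFrom c cs × lastFrom c cs ~ c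

  walk-lookup : ∀ {xs} → Walk xs → ∀ i j → suc (toℕ i) ≡ toℕ j → lookup xs i ~ lookup xs j
  walk-lookup {x ∷ y ∷ ys} (x~y , _) zero    (suc zero)    _  = x~y
  walk-lookup {x ∷ y ∷ ys} (_ , w)   (suc i) (suc j)       eq = walk-lookup {y ∷ ys} w i j (suc-injective eq)
  walk-lookup {x ∷ y ∷ ys} _         zero    (suc (suc j)) ()
  walk-lookup {x ∷ []}     _         zero    zero          ()

  walkFrom-++⁻ : ∀ x as bs → WalkFrom x (as ++ bs) → WalkFrom x as × WalkFrom (lastFrom x as) bs
  walkFrom-++⁻ x []       bs w         = tt , w
  walkFrom-++⁻ x (a ∷ as) bs (x~a , w) = let w₁ , w₂ = walkFrom-++⁻ a as bs w in (x~a , w₁) , w₂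

  walkFrom-++⁺ : ∀ x as bs → WalkFrom x as → WalkFrom (lastFrom x as) bs → WalkFrom x (as ++ bs)
  walkFrom-++⁺ x []       bs _          w₂ = w₂
  walkFrom-++⁺ x (a ∷ as) bs (x~a , w₁) w₂ = x~a , walkFrom-++⁺ a as bs w₁ w₂

  walkFrom-ʳ++ : ∀ {u} x as acc → u ~ lastFrom x as → WalkFrom x as → WalkFrom x acc →
                 WalkFrom u (as ʳ++ x ∷ acc)
  walkFrom-ʳ++ x []       acc u~x _          w = u~x , w
  walkFrom-ʳ++ x (a ∷ as) acc u~  (x~a , w₁) w = walkFrom-ʳ++ a as (x ∷ acc) u~ w₁ (~-sym x~a , w)

  -- Pósa's rotation: the chords x b and a y turn the walk x … a b … y into the cycle b … y a … x.
  cycle-from-chords : ∀ x as b bs → WalkFrom x (as ++ b ∷ bs) → x ~ b → lastFrom x as ~ lastFrom b bs →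
                      Cycle b (bs ++ as ʳ++ [ x ])
  cycle-from-chords x as b bs walk x~b a~y = around , closing
    where
    split : WalkFrom x as × WalkFrom (lastFrom x as) (b ∷ bs)
    split = walkFrom-++⁻ x as (b ∷ bs) walk
    around : WalkFrom b (bs ++ as ʳ++ [ x ])
    around = walkFrom-++⁺ b bs (as ʳ++ [ x ]) (proj₂ (proj₂ split))
               (walkFrom-ʳ++ x as [] (~-sym a~y) (proj₁ split) tt)
    closing : lastFrom b (bs ++ as ʳ++ [ x ]) ~ b
    closing = subst (_~ b) (sym (trans (lastFrom-++ b bs (as ʳ++ [ x ])) (lastFrom-ʳ++ _ x as []))) x~b

  cycle-rotate : ∀ {w} c cs → Cycle c cs → w ∈ c ∷ cs → ∃[ ys ] w ∷ ys ↭ c ∷ cs × WalkFrom w ys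
  cycle-rotate c cs (walk , closing) w∈ with ∈-∃++ w∈
  ... | []       , post , refl = cs , ↭-refl , walk
  cycle-rotate {w} c cs (walk , closing) w∈ | .c ∷ pre , post , refl =
    post ++ c ∷ pre , ++-comm (w ∷ post) (c ∷ pre) , walkFrom-++⁺ w post (c ∷ pre) after (closing′ , before)
    where
    split : WalkFrom c pre × WalkFrom (lastFrom c pre) (w ∷ post)
    split = walkFrom-++⁻ c pre (w ∷ post) walk
    before : WalkFrom c pre
    before = proj₁ split
    after : WalkFrom w post
    after = proj₂ (proj₂ split)
    closing′ : lastFrom w post ~ c
    closing′ = subst (_~ c) (lastFrom-++ c pre (w ∷ post)) closing

module ErdősGallai {n : ℕ} (H : Graph n) where

  open import Data.Bool using (Bool; true; false; T; _∧_; not)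
  open import Data.Bool.Properties using (T?)
  open import Data.Empty using (⊥-elim)
  open import Data.Fin using (Fin)
  open import Data.Fin.Properties using (_≟_; any?)
  open import Data.List using (List; []; _∷_; _++_; [_]; _ʳ++_; length; map)
  open import Data.List.Properties using (length-++)
  open import Data.List.Membership.Propositional using (_∈_; _∉_; find)
  import Data.List.Membership.DecPropositional as DecMembership
  open import Data.List.Relation.Unary.All as All using (All; []; _∷_)
  open import Data.List.Relation.Unary.All.Properties using (¬Any⇒All¬; ++⁺)
  open import Data.List.Relation.Unary.Any using (here)
  open import Data.List.Relation.Unary.Unique.Propositional using (Unique; []; _∷_)
  import Data.List.Relation.Unary.Unique.Propositional.Properties as Unique
  import Data.List.Relation.Unary.Unique.DecPropositional as DecUnique
  open import Data.List.Relation.Binary.Permutation.Propositional using (_↭_; ↭-sym; ↭-trans)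
  open import Data.List.Relation.Binary.Permutation.Propositional.Properties using (All-resp-↭; ∈-resp-↭; ↭-length)
  open import Data.Nat using (zero; suc; _+_; _*_; _≤_; _<_; _≤?_; s≤s)
  open import Data.Nat.Properties
    using (≤-refl; ≤-trans; ≤-reflexive; <-≤-trans; ≤-<-trans; ≤-pred; n≤1+n; ≤-total; ≰⇒>; <⇒≱;
           +-comm; +-assoc; +-identityʳ; +-mono-≤; +-monoˡ-≤; +-monoʳ-≤; m<n+m;
           *-identityˡ; *-identityʳ; *-zeroʳ; *-distribʳ-+; *-monoˡ-≤; module ≤-Reasoning)
  open import Data.Product using (_×_; _,_; proj₁; proj₂; ∃₂)
  open import Data.Sum using (inj₁; inj₂)
  open import Data.Unit using (tt)
  open import Function using (_∘_; id)
  open import Relation.Binary.PropositionalEquality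
    using (_≡_; refl; sym; trans; cong; cong₂; subst; subst₂; module ≡-Reasoning)
  open import Relation.Nullary using (¬_; Dec; yes; no; does; _×-dec_)
  open import Defs using (adj)
  open Sums
  open Lists
  open DecMembership (_≟_ {n}) using (_∈?_)
  open DecUnique (_≟_ {n}) using (unique?)

  VertexSet : Set
  VertexSet = Fin n → Bool

  _∩_ _∖_ : VertexSet → VertexSet → VertexSet
  (S ∩ C) v = S v ∧ C v
  (S ∖ C) v = S v ∧ not (C v)

  _⊆_ : VertexSet → VertexSet → Set
  A ⊆ B = ∀ v → T (A v) → T (B v)

  everything : VertexSet
  everything _ = true

  ｛_｝ : Fin n → VertexSet
  ｛ v ｝ w = does (w ≟ v)

  onPath : List (Fin n) → VertexSet
  onPath P w = does (w ∈? P)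

  ∩-⊆ʳ : ∀ S C → (S ∩ C) ⊆ C
  ∩-⊆ʳ S C v t with S v
  ... | true = t

  ∖-⊆ : ∀ S C → (S ∖ C) ⊆ S
  ∖-⊆ S C v t with S v
  ... | true = tt

  ∩-intro : ∀ S C {v} → T (S v) → T (C v) → T ((S ∩ C) v)
  ∩-intro S C {v} Sv Cv with S v
  ... | true = Cv

  ∈-｛｝ : ∀ v → T (｛ v ｝ v)
  ∈-｛｝ v with v ≟ v
  ... | yes _   = tt
  ... | no  v≢v = v≢v refl

  ∈-onPath-head : ∀ x xs → T (onPath (x ∷ xs) x)
  ∈-onPath-head x xs with x ≟ x
  ... | yes _   = tt
  ... | no  x≢x = ⊥-elim (x≢x refl)

  onPath⇒∈ : ∀ P {w} → T (onPath P w) → w ∈ P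
  onPath⇒∈ P {w} _ with w ∈? P
  ... | yes w∈P = w∈P

  size : VertexSet → ℕ
  size S = ∑[ v < n ] 𝟙 (S v)

  deg : VertexSet → Fin n → ℕ
  deg B u = ∑[ w < n ] (B w ⊙ 𝟙 (adj H u w))

  -- Ordered pairs of adjacent vertices: arcs S S is twice the number of edges inside S.
  arcs : VertexSet → VertexSet → ℕ
  arcs A B = ∑[ u < n ] (A u ⊙ deg B u)

  size-split : ∀ S C → size S ≡ size (S ∩ C) + size (S ∖ C)
  size-split S C = ∑-split S C (λ _ → 1)

  size-≥1 : ∀ S {v} → T (S v) → 1 ≤ size S
  size-≥1 S {v} Sv with S v | ∑-≥-term (𝟙 ∘ S) v
  ... | true | 1≤size = 1≤size

  size-∖-< : ∀ {S C v} → T ((S ∩ C) v) → size (S ∖ C) < size S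
  size-∖-< {S} {C} v∈ =
    subst (size (S ∖ C) <_) (sym (size-split S C)) (m<n+m (size (S ∖ C)) (size-≥1 (S ∩ C) v∈))

  size-everything : size everything ≡ n
  size-everything = trans (∑-const n 1) (*-identityʳ n)

  deg-split : ∀ B C u → deg B u ≡ deg (B ∩ C) u + deg (B ∖ C) u
  deg-split B C u = ∑-split B C (λ w → 𝟙 (adj H u w))

  deg-mono : ∀ {B B'} → B ⊆ B' → ∀ u → deg B u ≤ deg B' u
  deg-mono B⊆B' u = ∑-mono-≤ (λ w → ⊙-mono-≤ (B⊆B' w) (λ _ → ≤-refl))

  deg-｛｝ : ∀ v u → deg ｛ v ｝ u ≡ 𝟙 (adj H u v)
  deg-｛｝ v u = ∑-⊙-≟ v (λ w → 𝟙 (adj H u w))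

  arcs-splitˡ : ∀ A B C → arcs A B ≡ arcs (A ∩ C) B + arcs (A ∖ C) B
  arcs-splitˡ A B C = ∑-split A C (deg B)

  arcs-splitʳ : ∀ A B C → arcs A B ≡ arcs A (B ∩ C) + arcs A (B ∖ C)
  arcs-splitʳ A B C =
    trans (sum-cong-≗ (λ u → trans (cong (A u ⊙_) (deg-split B C u)) (⊙-distribˡ-+ (A u) _ _)))
          (∑-distrib-+ (λ u → A u ⊙ deg (B ∩ C) u) (λ u → A u ⊙ deg (B ∖ C) u))

  arcs-sym : ∀ A B → arcs A B ≡ arcs B A
  arcs-sym A B = begin
    ∑[ u < n ] (A u ⊙ deg B u)
      ≡⟨ sum-cong-≗ (λ u → ⊙-∑ (A u) (λ w → B w ⊙ 𝟙 (adj H u w))) ⟩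
    ∑[ u < n ] ∑[ w < n ] (A u ⊙ B w ⊙ 𝟙 (adj H u w))
      ≡⟨ ∑-comm (λ u w → A u ⊙ B w ⊙ 𝟙 (adj H u w)) ⟩
    ∑[ w < n ] ∑[ u < n ] (A u ⊙ B w ⊙ 𝟙 (adj H u w))
      ≡⟨ sum-cong-≗ (λ w → sum-cong-≗ (λ u → swap u w)) ⟩
    ∑[ w < n ] ∑[ u < n ] (B w ⊙ A u ⊙ 𝟙 (adj H w u))
      ≡⟨ sum-cong-≗ (λ w → ⊙-∑ (B w) (λ u → A u ⊙ 𝟙 (adj H w u))) ⟨
    ∑[ w < n ] (B w ⊙ deg A w) ∎
    where
    open ≡-Reasoning
    swap : ∀ u w → A u ⊙ B w ⊙ 𝟙 (adj H u w) ≡ B w ⊙ A u ⊙ 𝟙 (adj H w u)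
    swap u w = trans (⊙-comm (A u) (B w) _) (cong (λ b → B w ⊙ A u ⊙ 𝟙 b) (Graph.sym H u w))

  arcs-split : ∀ S C → let A = S ∩ C; B = S ∖ C in
               arcs S S ≡ arcs A A + (arcs A B + arcs A B) + arcs B B
  arcs-split S C = begin
    arcs S S                                      ≡⟨ arcs-splitˡ S S C ⟩
    arcs A S + arcs B S                           ≡⟨ cong₂ _+_ (arcs-splitʳ A S C) (arcs-splitʳ B S C) ⟩
    (arcs A A + arcs A B) + (arcs B A + arcs B B) ≡⟨ cong (λ x → arcs A A + arcs A B + (x + arcs B B)) (arcs-sym B A) ⟩
    (arcs A A + arcs A B) + (arcs A B + arcs B B) ≡⟨ sym (+-assoc (arcs A A + arcs A B) (arcs A B) (arcs B B)) ⟩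
    (arcs A A + arcs A B) + arcs A B + arcs B B   ≡⟨ cong (_+ arcs B B) (+-assoc (arcs A A) (arcs A B) (arcs A B)) ⟩
    arcs A A + (arcs A B + arcs A B) + arcs B B   ∎
    where
    open ≡-Reasoning
    A B : VertexSet
    A = S ∩ C
    B = S ∖ C

  arcs-mono : ∀ {A A' B B'} → A ⊆ A' → B ⊆ B' → arcs A B ≤ arcs A' B'
  arcs-mono A⊆A' B⊆B' = ∑-mono-≤ (λ u → ⊙-mono-≤ (A⊆A' u) (λ _ → deg-mono B⊆B' u))

  arcs-≤-size* : ∀ {A B d} → (∀ u → T (A u) → deg B u ≤ d) → arcs A B ≤ size A * d
  arcs-≤-size* {A} {B} {d} deg≤d = begin
    ∑[ u < n ] (A u ⊙ deg B u) ≤⟨ ∑-mono-≤ (λ u → ⊙-mono-≤ id (deg≤d u)) ⟩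
    ∑[ u < n ] (A u ⊙ d)       ≡⟨ sum-cong-≗ (λ u → ⊙≡𝟙* (A u) d) ⟩
    ∑[ u < n ] (𝟙 (A u) * d)   ≡⟨ *-distribʳ-sum d (𝟙 ∘ A) ⟨
    size A * d                 ∎
    where open ≤-Reasoning

  arcs-｛｝ˡ : ∀ v B → arcs ｛ v ｝ B ≡ deg B v
  arcs-｛｝ˡ v B = ∑-⊙-≟ v (deg B)

  -- Splitting C off S costs at most j arcs per vertex of S ∩ C.
  Light : VertexSet → ℕ → VertexSet → Set
  Light S j C = let A = S ∩ C; B = S ∖ C in arcs A A + (arcs A B + arcs A B) ≤ size A * j

  arcs-≤-split-light : ∀ S C j → Light S j C → arcs (S ∖ C) (S ∖ C) ≤ size (S ∖ C) * j →
                       arcs S S ≤ size S * j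
  arcs-≤-split-light S C j light rest = begin
    arcs S S                                    ≡⟨ arcs-split S C ⟩
    arcs A A + (arcs A B + arcs A B) + arcs B B ≤⟨ +-mono-≤ light rest ⟩
    size A * j + size B * j                     ≡⟨ *-distribʳ-+ j (size A) (size B) ⟨
    (size A + size B) * j                       ≡⟨ cong (_* j) (size-split S C) ⟨
    size S * j                                  ∎
    where
    open ≤-Reasoning
    A B : VertexSet
    A = S ∩ C
    B = S ∖ C

  low-degree-light : ∀ {S v j} → T (S v) → deg S v + deg S v ≤ j → Light S j ｛ v ｝
  low-degree-light {S} {v} {j} Sv low = begin
    arcs A A + (arcs A B + arcs A B) ≤⟨ +-mono-≤ AA≤0 (+-mono-≤ AB≤deg AB≤deg) ⟩
    0 + (deg S v + deg S v)          ≤⟨ low ⟩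
    j                                ≡⟨ *-identityˡ j ⟨
    1 * j                            ≤⟨ *-monoˡ-≤ j (size-≥1 A (∩-intro S ｛ v ｝ Sv (∈-｛｝ v))) ⟩
    size A * j                       ∎
    where
    open ≤-Reasoning
    A B : VertexSet
    A = S ∩ ｛ v ｝
    B = S ∖ ｛ v ｝
    AA≤0 : arcs A A ≤ 0
    AA≤0 = ≤-trans (arcs-mono (∩-⊆ʳ S ｛ v ｝) (∩-⊆ʳ S ｛ v ｝))
                   (≤-reflexive (trans (arcs-｛｝ˡ v ｛ v ｝) (trans (deg-｛｝ v v) (cong 𝟙 (Graph.irrefl H v)))))
    AB≤deg : arcs A B ≤ deg S v
    AB≤deg = ≤-trans (arcs-mono (∩-⊆ʳ S ｛ v ｝) (∖-⊆ S ｛ v ｝)) (≤-reflexive (arcs-｛｝ˡ v S))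

  _~_ : Fin n → Fin n → Set
  u ~ v = T (adj H u v)

  ~-sym : ∀ {u v} → u ~ v → v ~ u
  ~-sym {u} {v} = subst T (Graph.sym H u v)

  open Walks _~_ ~-sym public

  Path : VertexSet → List (Fin n) → Set
  Path S xs = All (T ∘ S) xs × Unique xs × Walk xs

  NoPath : VertexSet → ℕ → Set
  NoPath S t = ∀ xs → length xs ≡ t → ¬ Path S xs

  walk? : ∀ xs → Dec (Walk xs)
  walk? []       = yes tt
  walk? (x ∷ xs) = walkFrom? x xs
    where
    walkFrom? : ∀ x xs → Dec (WalkFrom x xs)
    walkFrom? x []       = yes tt
    walkFrom? x (y ∷ ys) = T? (adj H x y) ×-dec walkFrom? y ys

  path? : ∀ S xs → Dec (Path S xs)
  path? S xs = All.all? (T? ∘ S) xs ×-dec unique? xs ×-dec walk? xs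

  NoPath-mono : ∀ {S S' t} → S' ⊆ S → NoPath S t → NoPath S' t
  NoPath-mono S'⊆S noPath xs |xs| (inside , rest) = noPath xs |xs| (All.map (S'⊆S _) inside , rest)

  path-↭ : ∀ {S xs ys} → xs ↭ ys → Path S ys → Walk xs → Path S xs
  path-↭ xs↭ys (inside , uniq , _) walk = All-resp-↭ (↭-sym xs↭ys) inside , unique-resp-↭ xs↭ys uniq , walk

  extend-head : ∀ {S z x xs} → Path S (x ∷ xs) → T (S z) → z ∉ x ∷ xs → z ~ x → Path S (z ∷ x ∷ xs)
  extend-head (inside , uniq , walk) Sz z∉ z~x = Sz ∷ inside , ¬Any⇒All¬ _ z∉ ∷ uniq , z~x , walk

  extend-last : ∀ {S z x xs} → Path S (x ∷ xs) → T (S z) → z ∉ x ∷ xs → lastFrom x xs ~ z →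
                Path S (x ∷ xs ++ [ z ])
  extend-last {z = z} {x} {xs} (inside , uniq , walk) Sz z∉ last~z =
    ++⁺ inside (Sz ∷ []) , Unique.++⁺ uniq ([] ∷ []) disjoint , walkFrom-++⁺ x xs [ z ] walk (last~z , tt)
    where
    disjoint : ∀ {v} → ¬ (v ∈ x ∷ xs × v ∈ [ z ])
    disjoint (v∈ , here refl) = z∉ v∈

  head-nbr-on-longest-path : ∀ {S x xs z} → Path S (x ∷ xs) → NoPath S (2 + length xs) →
                             T (S z) → x ~ z → z ∈ x ∷ xs
  head-nbr-on-longest-path {x = x} {xs} {z} path noPath Sz x~z with z ∈? x ∷ xs
  ... | yes z∈ = z∈
  ... | no  z∉ = ⊥-elim (noPath (z ∷ x ∷ xs) refl (extend-head path Sz z∉ (~-sym x~z)))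

  last-nbr-on-longest-path : ∀ {S x xs z} → Path S (x ∷ xs) → NoPath S (2 + length xs) →
                             T (S z) → lastFrom x xs ~ z → z ∈ x ∷ xs
  last-nbr-on-longest-path {x = x} {xs} {z} path noPath Sz last~z with z ∈? x ∷ xs
  ... | yes z∈ = z∈
  ... | no  z∉ = ⊥-elim (noPath (x ∷ xs ++ [ z ]) |xs++z| (extend-last path Sz z∉ last~z))
    where
    |xs++z| : length (x ∷ xs ++ [ z ]) ≡ 2 + length xs
    |xs++z| = cong suc (trans (length-++ xs) (+-comm (length xs) 1))

  deg-on-path : ∀ {S P u} → Path S P → (∀ z → T (S z) → u ~ z → z ∈ P) → deg S u ≡ count (adj H u) P
  deg-on-path {S} {P} {u} (inside , uniq , _) nbrs-on-P = trans (sum-cong-≗ on-P) (∑-count (adj H u) P uniq)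
    where
    on-P : ∀ w → S w ⊙ 𝟙 (adj H u w) ≡ onPath P w ⊙ 𝟙 (adj H u w)
    on-P w with w ∈? P | S w in Sw | adj H u w in u~w
    ... | yes w∈P | true  | _     = refl
    ... | yes w∈P | false | _     = ⊥-elim (subst T Sw (All.lookup inside w∈P))
    ... | no  _   | false | _     = refl
    ... | no  _   | true  | false = refl
    ... | no  w∉P | true  | true  = ⊥-elim (w∉P (nbrs-on-P w (subst T (sym Sw) tt) (subst T (sym u~w) tt)))

  endpoint-counts-via-pairs : ∀ x xs → let y = lastFrom x xs in
    count (adj H x) xs + count (adj H y) (x ∷ xs) ≡
    count (adj H x ∘ proj₂) (pairs x xs) + count (adj H y ∘ proj₁) (pairs x xs)
  endpoint-counts-via-pairs x xs = cong₂ _+_ head-count last-count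
    where
    y : Fin n
    y = lastFrom x xs
    head-count : count (adj H x) xs ≡ count (adj H x ∘ proj₂) (pairs x xs)
    head-count = trans (cong (count (adj H x)) (sym (map-proj₂-pairs x xs))) (count-map (adj H x) proj₂ (pairs x xs))
    last-count : count (adj H y) (x ∷ xs) ≡ count (adj H y ∘ proj₁) (pairs x xs)
    last-count = begin
      count (adj H y) (x ∷ xs)                     ≡⟨ cong (count (adj H y)) (map-proj₁-pairs x xs) ⟨
      count (adj H y) (firsts ++ [ y ])            ≡⟨ count-++ (adj H y) firsts [ y ] ⟩
      count (adj H y) firsts + (𝟙 (adj H y y) + 0) ≡⟨ cong (λ b → count (adj H y) firsts + (𝟙 b + 0))
                                                          (Graph.irrefl H y) ⟩
      count (adj H y) firsts + 0                   ≡⟨ +-identityʳ _ ⟩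
      count (adj H y) firsts                       ≡⟨ count-map (adj H y) proj₁ (pairs x xs) ⟩
      count (adj H y ∘ proj₁) (pairs x xs)         ∎
      where
      open ≡-Reasoning
      firsts : List (Fin n)
      firsts = map proj₁ (pairs x xs)

  spanning-cycle : ∀ x xs → WalkFrom x xs →
                   length xs < count (adj H x) xs + count (adj H (lastFrom x xs)) (x ∷ xs) →
                   ∃₂ λ c cs → Cycle c cs × c ∷ cs ↭ x ∷ xs
  spanning-cycle x xs walk many-nbrs
    with (a , b) , ab∈ , x~b , y~a
           ← find (pigeonhole (adj H x ∘ proj₂) (adj H (lastFrom x xs) ∘ proj₁) (pairs x xs)
                    (subst₂ _<_ (sym (length-pairs x xs)) (endpoint-counts-via-pairs x xs) many-nbrs))
    with as , bs , refl , refl ← ∈-pairs⁻ xs ab∈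
    = b , bs ++ as ʳ++ [ x ] , cycle-from-chords x as b bs walk x~b (~-sym y~a′) , ↭-rotate-segment x as b bs
    where
    y~a′ : lastFrom b bs ~ lastFrom x as
    y~a′ = subst (_~ lastFrom x as) (lastFrom-++ x as (b ∷ bs)) y~a

  longest-path-closed : ∀ {S P c cs w z} → Path S P → NoPath S (suc (length P)) →
                        Cycle c cs → c ∷ cs ↭ P → w ∈ P → T (S z) → z ∉ P → ¬ w ~ z
  longest-path-closed {P = P} {c} {cs} {w} {z} path noPath cycle c∷cs↭P w∈P Sz z∉P w~z
    with ys , w∷ys↭c∷cs , walk ← cycle-rotate c cs cycle (∈-resp-↭ (↭-sym c∷cs↭P) w∈P)
    = noPath (z ∷ w ∷ ys) (cong suc (↭-length w∷ys↭P))
        (extend-head (path-↭ w∷ys↭P path walk) Sz (z∉P ∘ ∈-resp-↭ w∷ys↭P) (~-sym w~z))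
    where
    w∷ys↭P : w ∷ ys ↭ P
    w∷ys↭P = ↭-trans w∷ys↭c∷cs c∷cs↭P

  longest-path-light : ∀ {S P c cs j} → Path S P → length P ≤ suc j → NoPath S (suc (length P)) →
                       Cycle c cs → c ∷ cs ↭ P → Light S j (onPath P)
  longest-path-light {S} {P} {j = j} path@(_ , uniq , _) |P|≤ noPath cycle c∷cs↭P = begin
    arcs A A + (arcs A B + arcs A B) ≤⟨ +-mono-≤ AA≤ (+-mono-≤ AB≤0 AB≤0) ⟩
    size A * j + 0                   ≡⟨ +-identityʳ _ ⟩
    size A * j                       ∎
    where
    open ≤-Reasoning
    A B : VertexSet
    A = S ∩ onPath P
    B = S ∖ onPath P
    on-P : ∀ {u} → T (A u) → u ∈ P
    on-P {u} u∈A = onPath⇒∈ P (∩-⊆ʳ S (onPath P) u u∈A)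
    deg-inside : ∀ u → T (A u) → deg A u ≤ j
    deg-inside u u∈A = ≤-pred (begin
      suc (deg A u)           ≤⟨ s≤s (deg-mono (∩-⊆ʳ S (onPath P)) u) ⟩
      suc (deg (onPath P) u)  ≡⟨ cong suc (∑-count (adj H u) P uniq) ⟩
      suc (count (adj H u) P) ≤⟨ count-<-length (adj H u) (on-P u∈A) (Graph.irrefl H u) ⟩
      length P                ≤⟨ |P|≤ ⟩
      suc j                   ∎)
    deg-outside : ∀ u → T (A u) → deg B u ≤ 0
    deg-outside u u∈A = ≤-reflexive (∑-zero no-arc)
      where
      no-arc : ∀ w → B w ⊙ 𝟙 (adj H u w) ≡ 0
      no-arc w with S w in Sw | w ∈? P | adj H u w in u~w
      ... | false | _      | _     = refl
      ... | true  | yes _  | _     = refl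
      ... | true  | no  _  | false = refl
      ... | true  | no w∉P | true  = ⊥-elim (longest-path-closed path noPath cycle c∷cs↭P (on-P u∈A)
                                                (subst T (sym Sw) tt) w∉P (subst T (sym u~w) tt))
    AA≤ : arcs A A ≤ size A * j
    AA≤ = arcs-≤-size* {A} {A} deg-inside
    AB≤0 : arcs A B ≤ 0
    AB≤0 = ≤-trans (arcs-≤-size* {A} {B} deg-outside) (≤-reflexive (*-zeroʳ (size A)))

  longest-path : ∀ {S u} j → T (S u) → NoPath S (2 + j) →
                 ∃₂ λ x xs → Path S (x ∷ xs) × length xs ≤ j × NoPath S (2 + length xs)
  longest-path {S} {u} j Su noPath = search j ≤-refl noPath
    where
    search : ∀ t → t ≤ j → NoPath S (2 + t) →
             ∃₂ λ x xs → Path S (x ∷ xs) × length xs ≤ j × NoPath S (2 + length xs)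
    search t t≤j noLonger with ∃-list? (Path S) (path? S) (suc t)
    ... | yes (x ∷ xs , refl , path) = x , xs , path , t≤j , noLonger
    ... | no none with t
    ...   | zero   = ⊥-elim (none ([ u ] , refl , Su ∷ [] , [] ∷ [] , tt))
    ...   | suc t' = search t' (≤-trans (n≤1+n t') t≤j) (λ xs |xs| path → none (xs , |xs| , path))

  longest-path-spanning-cycle : ∀ {S x xs j} → Path S (x ∷ xs) → length xs ≤ j → NoPath S (2 + length xs) →
                                (∀ v → T (S v) → j < deg S v + deg S v) →
                                ∃₂ λ c cs → Cycle c cs × c ∷ cs ↭ x ∷ xs
  longest-path-spanning-cycle {S} {x} {xs} {j} path@(inside , _ , walk) |xs|≤j noPath high =
    spanning-cycle x xs walk (≤-<-trans |xs|≤j (subst₂ (λ a b → j < a + b) deg-x deg-y j<))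
    where
    y : Fin n
    y = lastFrom x xs
    deg-x : deg S x ≡ count (adj H x) xs
    deg-x = trans (deg-on-path path (λ z Sz → head-nbr-on-longest-path path noPath Sz))
                  (cong (λ b → 𝟙 b + count (adj H x) xs) (Graph.irrefl H x))
    deg-y : deg S y ≡ count (adj H y) (x ∷ xs)
    deg-y = deg-on-path path (λ z Sz → last-nbr-on-longest-path path noPath Sz)
    j< : j < deg S x + deg S y
    j< with ≤-total (deg S x) (deg S y) | high x (All.head inside) | high y (All.lookup inside (lastFrom-∈ x xs))
    ... | inj₁ x≤y | j<2x | _    = <-≤-trans j<2x (+-monoʳ-≤ (deg S x) x≤y)
    ... | inj₂ y≤x | _    | j<2y = <-≤-trans j<2y (+-monoˡ-≤ (deg S y) y≤x)

  light-part : ∀ {S u} j → T (S u) → NoPath S (2 + j) → ∃₂ λ C w → T ((S ∩ C) w) × Light S j C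
  light-part {S} {u} j Su noPath with any? (λ v → T? (S v) ×-dec (deg S v + deg S v ≤? j))
  ... | yes (v , Sv , low) = ｛ v ｝ , v , ∩-intro S ｛ v ｝ Sv (∈-｛｝ v) , low-degree-light Sv low
  ... | no no-low
    with x , xs , path , |xs|≤j , noLonger ← longest-path j Su noPath
    with c , cs , cycle , c∷cs↭P ← longest-path-spanning-cycle path |xs|≤j noLonger
                                     (λ v Sv → ≰⇒> (λ low → no-low (v , Sv , low)))
    = onPath (x ∷ xs) , x , ∩-intro S (onPath (x ∷ xs)) (All.head (proj₁ path)) (∈-onPath-head x xs)
    , longest-path-light path (s≤s |xs|≤j) noLonger cycle c∷cs↭P

  erdős-gallai-within : ∀ j m S → size S ≤ m → NoPath S (2 + j) → arcs S S ≤ size S * j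
  erdős-gallai-within j m S size≤m noPath with any? (λ v → T? (S v))
  ... | no empty = arcs-≤-size* {S} {S} (λ u Su → ⊥-elim (empty (u , Su)))
  ... | yes (u , Su) with m | light-part j Su noPath
  ...   | zero  | _ = ⊥-elim (<⇒≱ (size-≥1 S Su) size≤m)
  ...   | suc m | C , w , w∈ , light =
    arcs-≤-split-light S C j light
      (erdős-gallai-within j m (S ∖ C) (≤-pred (≤-trans (size-∖-< w∈) size≤m))
                           (NoPath-mono (∖-⊆ S C) noPath))

  erdős-gallai : ∀ j → NoPath everything (2 + j) → arcs everything everything ≤ n * j
  erdős-gallai j noPath =
    subst (λ k → arcs everything everything ≤ k * j) size-everything
          (erdős-gallai-within j n everything (≤-reflexive size-everything) noPath)

module Handshake {n : ℕ} (G : Graph n) where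

  open import Data.Bool using (Bool; true; false; T; _∧_)
  open import Data.Empty using (⊥-elim)
  open import Data.Fin using (Fin; toℕ)
  open import Data.Fin.Properties using (toℕ-injective)
  open import Data.List using (List; map; concatMap; allFin)
  open import Data.Nat using (_+_; _<_; _<ᵇ_)
  open import Data.Nat.Properties using (<ᵇ⇒<; <⇒<ᵇ; <-asym; ≤-antisym; ≮⇒≥; +-identityʳ)
  open import Data.Product using (_×_; _,_)
  open import Data.Unit using (tt)
  open import Function using (id)
  open import Relation.Binary.PropositionalEquality
    using (_≡_; refl; sym; trans; cong; cong₂; subst; module ≡-Reasoning)
  open import Relation.Nullary using (¬_)
  open import Defs using (adj; edgeCount)
  open Sums
  open Lists

  forwardEdge : Fin n × Fin n → Bool
  forwardEdge (i , j) = (toℕ i <ᵇ toℕ j) ∧ adj G i j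

  edgeCount≡ : edgeCount G ≡ ∑[ i < n ] ∑[ j < n ] 𝟙 (forwardEdge (i , j))
  edgeCount≡ = begin
    edgeCount G                                    ≡⟨ length-filter forwardEdge (concatMap row (allFin n)) ⟩
    count forwardEdge (concatMap row (allFin n))   ≡⟨ count-concatMap-tabulate forwardEdge row id ⟩
    ∑[ i < n ] count forwardEdge (row i)           ≡⟨ sum-cong-≗ count-row ⟩
    ∑[ i < n ] ∑[ j < n ] 𝟙 (forwardEdge (i , j))  ∎
    where
    open ≡-Reasoning
    row : Fin n → List (Fin n × Fin n)
    row i = map (i ,_) (allFin n)
    count-row : ∀ i → count forwardEdge (row i) ≡ ∑[ j < n ] 𝟙 (forwardEdge (i , j))
    count-row i = trans (count-map forwardEdge (i ,_) (allFin n)) (count-tabulate (λ j → forwardEdge (i , j)) id)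

  <ᵇ≡false⇒≮ : ∀ {a b} → (a <ᵇ b) ≡ false → ¬ a < b
  <ᵇ≡false⇒≮ a≮ᵇb a<b = subst T a≮ᵇb (<⇒<ᵇ a<b)

  adj-split : ∀ u w → 𝟙 (adj G u w) ≡ 𝟙 (forwardEdge (u , w)) + 𝟙 (forwardEdge (w , u))
  adj-split u w with toℕ u <ᵇ toℕ w in u<w | toℕ w <ᵇ toℕ u in w<u
  ... | true  | true  = ⊥-elim (<-asym (<ᵇ⇒< (toℕ u) (toℕ w) (subst T (sym u<w) tt))
                                       (<ᵇ⇒< (toℕ w) (toℕ u) (subst T (sym w<u) tt)))
  ... | true  | false = sym (+-identityʳ _)
  ... | false | true  = cong 𝟙 (Graph.sym G u w)
  ... | false | false
    with refl ← toℕ-injective {i = u} {j = w}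
                  (≤-antisym (≮⇒≥ (<ᵇ≡false⇒≮ w<u)) (≮⇒≥ (<ᵇ≡false⇒≮ u<w)))
    = cong 𝟙 (Graph.irrefl G u)

  handshake : edgeCount G + edgeCount G ≡ ∑[ u < n ] ∑[ w < n ] 𝟙 (adj G u w)
  handshake = begin
    edgeCount G + edgeCount G
      ≡⟨ cong₂ _+_ edgeCount≡ (trans edgeCount≡ (∑-comm F)) ⟩
    ∑[ u < n ] ∑[ w < n ] F u w + ∑[ w < n ] ∑[ u < n ] F u w
      ≡⟨ ∑-distrib-+ (λ u → ∑[ w < n ] F u w) (λ u → ∑[ w < n ] F w u) ⟨
    ∑[ u < n ] (∑[ w < n ] F u w + ∑[ w < n ] F w u)
      ≡⟨ sum-cong-≗ (λ u → ∑-distrib-+ (F u) (λ w → F w u)) ⟨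
    ∑[ u < n ] ∑[ w < n ] (F u w + F w u)
      ≡⟨ sum-cong-≗ (λ u → sum-cong-≗ (adj-split u)) ⟨
    ∑[ u < n ] ∑[ w < n ] 𝟙 (adj G u w) ∎
    where
    open ≡-Reasoning
    F : Fin n → Fin n → ℕ
    F i j = 𝟙 (forwardEdge (i , j))

module Colourings where

  open import Data.Bool using (Bool; true; false; T)
  open import Data.Fin using (Fin)
  open import Data.Fin.Properties using (_≟_; any?)
  open import Data.List using (length; lookup)
  open import Data.Nat using (_+_; _*_; _≤_)
  open import Data.Nat.Properties using (module ≤-Reasoning)
  open import Data.Product using (Σ; _,_)
  open import Data.Sum using (_⊎_; inj₁; inj₂)
  open import Data.Unit using (tt)
  open import Relation.Binary.PropositionalEquality using (_≡_; refl; sym; cong; subst)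
  open import Relation.Nullary using (does; yes; no)
  open import Defs using (adj; edgeCount; EdgeColouring; colour; colour-sym; MonoPath)
  open Sums
  open Lists

  hasColour : ∀ {r} (b : Bool) → (T b → Fin r) → Fin r → Bool
  hasColour false κ γ = false
  hasColour true  κ γ = does (γ ≟ κ tt)

  hasColour-cong : ∀ {r b b'} (κ : T b → Fin r) (κ' : T b' → Fin r) → b ≡ b' → (∀ e e' → κ e ≡ κ' e') →
                   ∀ γ → hasColour b κ γ ≡ hasColour b' κ' γ
  hasColour-cong {b = false} κ κ' refl κ≡κ' γ = refl
  hasColour-cong {b = true}  κ κ' refl κ≡κ' γ = cong (λ δ → does (γ ≟ δ)) (κ≡κ' tt tt)

  hasColour-absent : ∀ {r b} (κ : T b → Fin r) γ → b ≡ false → hasColour b κ γ ≡ false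
  hasColour-absent κ γ refl = refl

  hasColour⇒ : ∀ {r} b (κ : T b → Fin r) γ → T (hasColour b κ γ) → Σ (T b) λ e → κ e ≡ γ
  hasColour⇒ true κ γ _ with γ ≟ κ tt
  ... | yes γ≡κ = tt , sym γ≡κ

  ∑-hasColour : ∀ {r} b (κ : T b → Fin r) → ∑[ γ < r ] 𝟙 (hasColour b κ γ) ≡ 𝟙 b
  ∑-hasColour {r} false κ = ∑-zero {r} (λ _ → refl)
  ∑-hasColour     true  κ = ∑-⊙-≟ (κ tt) (λ _ → 1)

  module _ {n r} {G : Graph n} (c : EdgeColouring G r) where

    colourClass : Fin r → Graph n
    colourClass γ = record
      { adj    = λ u v → hasColour (adj G u v) (colour c u v) γ
      ; sym    = λ u v → hasColour-cong (colour c u v) (colour c v u) (Graph.sym G u v) (colour-sym c u v) γ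
      ; irrefl = λ u → hasColour-absent (colour c u u) γ (Graph.irrefl G u)
      }

    module Class (γ : Fin r) = ErdősGallai (colourClass γ)

    monoPath : ∀ γ xs → Class.Path γ (Class.everything γ) xs → MonoPath c (length xs)
    monoPath γ xs (_ , uniq , walk) = record
      { γ    = γ
      ; v    = lookup xs
      ; inj  = lookup-injective uniq
      ; edge = λ a b a+1≡b → hasColour⇒ (adj G (lookup xs a) (lookup xs b)) (colour c (lookup xs a) (lookup xs b)) γ
                                          (Class.walk-lookup γ {xs} walk a b a+1≡b)
      }

    no-monoPath⇒sparse : ∀ j → (∀ γ → Class.NoPath γ (Class.everything γ) (2 + j)) →
                         edgeCount G + edgeCount G ≤ r * (n * j)
    no-monoPath⇒sparse j noPath = begin
      edgeCount G + edgeCount G                  ≡⟨ Handshake.handshake G ⟩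
      ∑[ u < n ] ∑[ w < n ] 𝟙 (adj G u w)        ≡⟨ sum-cong-≗ (λ u → sum-cong-≗ (∑-colours u)) ⟨
      ∑[ u < n ] ∑[ w < n ] ∑[ γ < r ] A γ u w   ≡⟨ sum-cong-≗ (λ u → ∑-comm (λ w γ → A γ u w)) ⟩
      ∑[ u < n ] ∑[ γ < r ] ∑[ w < n ] A γ u w   ≡⟨ ∑-comm (λ u γ → ∑[ w < n ] A γ u w) ⟩
      ∑[ γ < r ] ∑[ u < n ] ∑[ w < n ] A γ u w   ≤⟨ ∑-mono-≤ (λ γ → Class.erdős-gallai γ j (noPath γ)) ⟩
      ∑[ γ < r ] (n * j)                         ≡⟨ ∑-const r (n * j) ⟩
      r * (n * j)                                ∎
      where
      open ≤-Reasoning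
      A : Fin r → Fin n → Fin n → ℕ
      A γ u w = 𝟙 (adj (colourClass γ) u w)
      ∑-colours : ∀ u w → ∑[ γ < r ] A γ u w ≡ 𝟙 (adj G u w)
      ∑-colours u w = ∑-hasColour (adj G u w) (colour c u w)

    monoPath-or-sparse : ∀ j → MonoPath c (2 + j) ⊎ edgeCount G + edgeCount G ≤ r * (n * j)
    monoPath-or-sparse j
      with any? (λ γ → ∃-list? (Class.Path γ (Class.everything γ)) (Class.path? γ (Class.everything γ)) (2 + j))
    ... | yes (γ , xs , |xs| , path) = inj₁ (subst (MonoPath c) |xs| (monoPath γ xs path))
    ... | no none                    = inj₂ (no-monoPath⇒sparse j (λ γ xs |xs| path → none (γ , xs , |xs| , path)))

module Arithmetic where

  open import Data.Nat as ℕ using (zero; suc; _+_; _*_; _∸_; z≤n; s≤s)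
  import Data.Nat.Properties as ℕ
  open import Data.Nat.Coprimality using (Coprime; 1-coprimeTo) renaming (sym to coprime-sym)
  open import Data.Integer as ℤ using (ℤ; +_; -[1+_]; +[1+_])
  import Data.Integer.Properties as ℤ
  open import Data.Integer.DivMod using (a≡a%n+[a/n]*n; n%d<d)
  open import Data.Rational as ℚ using (ℚ; mkℚ; 0ℚ; 1ℚ; ceiling; _<_; _≤_; *<*)
  import Data.Rational.Properties as ℚ
  import Data.Rational.Unnormalised as ℚᵘ
  import Data.Rational.Unnormalised.Properties as ℚᵘ
  open import Relation.Binary.PropositionalEquality
    using (_≡_; refl; sym; trans; cong; cong₂; subst; subst₂; module ≡-Reasoning)
  open import Algebra.Properties.CommutativeSemigroup ℕ.+-commutativeSemigroup
    using () renaming (interchange to +-interchange)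
  open import Defs using (ℕtoℚ; inv; pathOrder; choose2)

  ℕtoℚ≡mkℚ : ∀ m → ℕtoℚ m ≡ mkℚ (+ m) 0 (coprime-sym (1-coprimeTo m))
  ℕtoℚ≡mkℚ m = ℚ.normalize-coprime (coprime-sym (1-coprimeTo m))

  ℕtoℚ-cancel-< : ∀ {a b} → ℕtoℚ a < ℕtoℚ b → a ℕ.< b
  ℕtoℚ-cancel-< {a} {b} a<b rewrite ℕtoℚ≡mkℚ a | ℕtoℚ≡mkℚ b =
    ℤ.drop‿+<+ (subst₂ ℤ._<_ (ℤ.*-identityʳ (+ a)) (ℤ.*-identityʳ (+ b)) (ℚ.drop-*<* a<b))

  ℕtoℚ-homo-+ : ∀ a b → ℕtoℚ (a + b) ≡ ℕtoℚ a ℚ.+ ℕtoℚ b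
  ℕtoℚ-homo-+ a b =
    ℚ.toℚᵘ-injective (ℚᵘ.≃-trans toℚᵘ-sum (ℚᵘ.≃-sym (ℚ.toℚᵘ-homo-+ (ℕtoℚ a) (ℕtoℚ b))))
    where
    toℚᵘ-sum : ℚ.toℚᵘ (ℕtoℚ (a + b)) ℚᵘ.≃ ℚ.toℚᵘ (ℕtoℚ a) ℚᵘ.+ ℚ.toℚᵘ (ℕtoℚ b)
    toℚᵘ-sum rewrite ℕtoℚ≡mkℚ (a + b) | ℕtoℚ≡mkℚ a | ℕtoℚ≡mkℚ b =
      ℚᵘ.*≡* (cong (ℤ._* + 1)
        (trans (ℤ.pos-+ a b) (sym (cong₂ ℤ._+_ (ℤ.*-identityʳ (+ a)) (ℤ.*-identityʳ (+ b))))))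

  ℕtoℚ-homo-* : ∀ a b → ℕtoℚ (a * b) ≡ ℕtoℚ a ℚ.* ℕtoℚ b
  ℕtoℚ-homo-* a b =
    ℚ.toℚᵘ-injective (ℚᵘ.≃-trans toℚᵘ-product (ℚᵘ.≃-sym (ℚ.toℚᵘ-homo-* (ℕtoℚ a) (ℕtoℚ b))))
    where
    toℚᵘ-product : ℚ.toℚᵘ (ℕtoℚ (a * b)) ℚᵘ.≃ ℚ.toℚᵘ (ℕtoℚ a) ℚᵘ.* ℚ.toℚᵘ (ℕtoℚ b)
    toℚᵘ-product rewrite ℕtoℚ≡mkℚ (a * b) | ℕtoℚ≡mkℚ a | ℕtoℚ≡mkℚ b =
      ℚᵘ.*≡* (cong (ℤ._* + 1) (ℤ.pos-* a b))

  inv-inverse : ∀ r → inv (suc r) ℚ.* ℕtoℚ (suc r) ≡ 1ℚ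
  inv-inverse r rewrite ℕtoℚ≡mkℚ (suc r) | ℚ.normalize-coprime {1} {r} (1-coprimeTo (suc r)) =
    ℚ.*-inverseˡ (mkℚ +[1+ r ] 0 (coprime-sym (1-coprimeTo (suc r))))

  choose2-double : ∀ n → choose2 n + choose2 n ≡ n * (n ∸ 1)
  choose2-double zero    = refl
  choose2-double (suc n) = begin
    (n + choose2 n) + (n + choose2 n) ≡⟨ +-interchange n (choose2 n) n (choose2 n) ⟩
    (n + n) + (choose2 n + choose2 n) ≡⟨ cong (λ x → (n + n) + x) (choose2-double n) ⟩
    (n + n) + n * (n ∸ 1)             ≡⟨ ℕ.+-assoc n n _ ⟩
    n + (n + n * (n ∸ 1))             ≡⟨ cong (λ x → n + x) (n+n*[n-1]≡n*n n) ⟩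
    n + n * n                         ∎
    where
    open ≡-Reasoning
    n+n*[n-1]≡n*n : ∀ n → n + n * (n ∸ 1) ≡ n * n
    n+n*[n-1]≡n*n zero    = refl
    n+n*[n-1]≡n*n (suc m) = sym (ℕ.*-suc (suc m) m)

  ceiling-nonneg : ∀ N d .(c : Coprime N (suc d)) → ceiling (mkℚ (+ N) d c) ≡ ℤ.- ((ℤ.- (+ N)) ℤ./ + suc d)
  ceiling-nonneg zero    d c = refl
  ceiling-nonneg (suc N) d c = refl

  private
    quotient-bound : ∀ c N m d k → + (N + m) ≡ c ℤ.* + suc d → ℤ.∣ c ∣ ≡ suc k → m ℕ.< suc d →
                     k * suc d ℕ.< N
    quotient-bound +[1+ k ] N m d .k N+m≡ refl m<D =
      ℕ.+-cancelʳ-< (suc d) (k * suc d) N (begin-strict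
        k * suc d + suc d ≡⟨ ℕ.+-comm (k * suc d) (suc d) ⟩
        suc d + k * suc d ≡⟨ ℤ.+-injective (trans N+m≡ (sym (ℤ.pos-* (suc k) (suc d)))) ⟨
        N + m             <⟨ ℕ.+-monoʳ-< N m<D ⟩
        N + suc d         ∎)
      where open ℕ.≤-Reasoning
    quotient-bound -[1+ c ] N m d k () _ _

  -- ⌈N/D⌉ = -⌊-N/D⌋ and -N = m + ⌊-N/D⌋·D with 0 ≤ m < D, so ⌈N/D⌉·D = N + m < N + D.
  ceiling-quotient : ∀ N d k → ℤ.∣ ℤ.- ((ℤ.- (+ N)) ℤ./ + suc d) ∣ ≡ suc k → k * suc d ℕ.< N
  ceiling-quotient N d k ∣c∣≡ = quotient-bound c N m d k N+m≡cD ∣c∣≡ (n%d<d X D)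
    where
    open import Data.Integer.Solver using (module +-*-Solver)
    open +-*-Solver
    D X f c : ℤ
    D = + suc d
    X = ℤ.- (+ N)
    f = X ℤ./ D
    c = ℤ.- f
    m : ℕ
    m = X ℤ.% D
    N+m≡cD : + (N + m) ≡ c ℤ.* D
    N+m≡cD = begin
      + (N + m)                           ≡⟨ ℤ.pos-+ N m ⟩
      + N ℤ.+ + m                         ≡⟨ solve 4 (λ y m f d → y :+ m := (:- f) :* d :+ (y :+ (m :+ f :* d)))
                                                     refl (+ N) (+ m) f D ⟩
      c ℤ.* D ℤ.+ (+ N ℤ.+ (+ m ℤ.+ f ℤ.* D)) ≡⟨ cong (λ z → c ℤ.* D ℤ.+ (+ N ℤ.+ z))
                                                           (a≡a%n+[a/n]*n X D) ⟨
      c ℤ.* D ℤ.+ (+ N ℤ.+ X)             ≡⟨ cong (λ z → c ℤ.* D ℤ.+ z) (ℤ.+-inverseʳ (+ N)) ⟩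
      c ℤ.* D ℤ.+ + 0                     ≡⟨ ℤ.+-identityʳ _ ⟩
      c ℤ.* D                             ∎
      where open ≡-Reasoning

  ceiling-suc⇒< : ∀ q k → 0ℚ ≤ q → ℤ.∣ ceiling q ∣ ≡ suc k → ℕtoℚ k < q
  ceiling-suc⇒< (mkℚ (+ N) d c) k _ ⌈q⌉≡ rewrite ℕtoℚ≡mkℚ k =
    *<* (subst₂ ℤ._<_ (ℤ.pos-* k (suc d)) (sym (ℤ.*-identityʳ (+ N)))
          (ℤ.+<+ (ceiling-quotient N d k (trans (cong ℤ.∣_∣ (sym (ceiling-nonneg N d c))) ⌈q⌉≡))))
  ceiling-suc⇒< (mkℚ -[1+ N ] d c) k 0≤q _ with () ← ℚ.drop-*≤* 0≤q

  0<1-ε : ∀ {ε} → ε < 1ℚ → 0ℚ < 1ℚ ℚ.- ε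
  0<1-ε {ε} ε<1 = subst (_< 1ℚ ℚ.- ε) (ℚ.+-inverseʳ ε) (ℚ.+-monoˡ-< (ℚ.- ε) ε<1)

  1-ε≤1 : ∀ {ε} → 0ℚ < ε → 1ℚ ℚ.- ε ≤ 1ℚ
  1-ε≤1 {ε} 0<ε =
    ℚ.<⇒≤ (subst (1ℚ ℚ.- ε <_) (ℚ.+-identityʳ 1ℚ) (ℚ.+-monoʳ-< 1ℚ (ℚ.neg-antimono-< 0<ε)))

  pathOrder-bound : ∀ {ε} n r k → ε < 1ℚ → pathOrder ε n (suc r) ≡ suc k →
                    ℕtoℚ (k * suc r) < (1ℚ ℚ.- ε) ℚ.* ℕtoℚ n
  pathOrder-bound {ε} n r k ε<1 ⌈q⌉≡ = begin-strict
    ℕtoℚ (k * R)                    ≡⟨ ℕtoℚ-homo-* k R ⟩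
    ℕtoℚ k ℚ.* ℕtoℚ R               <⟨ ℚ.*-monoˡ-<-pos (ℕtoℚ R) {{ℚ.normalize-pos R 1}}
                                                          (ceiling-suc⇒< q k 0≤q ⌈q⌉≡) ⟩
    q ℚ.* ℕtoℚ R                    ≡⟨ ℚ.*-assoc (a ℚ.* N) (inv R) (ℕtoℚ R) ⟩
    a ℚ.* N ℚ.* (inv R ℚ.* ℕtoℚ R)  ≡⟨ cong (a ℚ.* N ℚ.*_) (inv-inverse r) ⟩
    a ℚ.* N ℚ.* 1ℚ                  ≡⟨ ℚ.*-identityʳ (a ℚ.* N) ⟩
    a ℚ.* N                         ∎
    where
    open ℚ.≤-Reasoning
    R : ℕ
    R = suc r
    a N q : ℚ
    a = 1ℚ ℚ.- ε
    N = ℕtoℚ n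
    q = a ℚ.* N ℚ.* inv R
    0≤q : 0ℚ ≤ q
    0≤q = ℚ.nonNegative⁻¹ q
            {{ℚ.nonNeg*nonNeg⇒nonNeg (a ℚ.* N)
                {{ℚ.nonNeg*nonNeg⇒nonNeg a {{ℚ.nonNegative (ℚ.<⇒≤ (0<1-ε ε<1))}} N {{ℚ.normalize-nonNeg n 1}}}}
                (inv R) {{ℚ.normalize-nonNeg 1 R}}}}

  rnj≤[j+1]r[n-1] : ∀ r n j → suc j ℕ.< n → r * (n * j) ℕ.≤ suc j * r * (n ∸ 1)
  rnj≤[j+1]r[n-1] r (suc n) j (s≤s j<n) = begin
    r * (suc n * j)      ≡⟨ solve 3 (λ r n j → r :* ((con 1 :+ n) :* j) := r :* j :+ r :* (n :* j)) refl r n j ⟩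
    r * j + r * (n * j)  ≤⟨ ℕ.+-monoˡ-≤ (r * (n * j)) (ℕ.*-monoʳ-≤ r (ℕ.<⇒≤ j<n)) ⟩
    r * n + r * (n * j)  ≡⟨ solve 3 (λ r n j → r :* n :+ r :* (n :* j) := (con 1 :+ j) :* r :* n) refl r n j ⟩
    suc j * r * n        ∎
    where
    open ℕ.≤-Reasoning
    open import Data.Nat.Solver using (module +-*-Solver)
    open +-*-Solver

  dense⇒many-edges : ∀ {ε E} n r j → 0ℚ < ε → ε < 1ℚ →
                     (1ℚ ℚ.- ε) ℚ.* ℕtoℚ (choose2 n) ≤ ℕtoℚ E →
                     pathOrder ε n (suc r) ≡ 2 + j → suc r * (n * j) ℕ.< E + E
  dense⇒many-edges {ε} {E} n r j 0<ε ε<1 dense ⌈q⌉≡ =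
    ℕ.≤-<-trans (rnj≤[j+1]r[n-1] R n j j+1<n) (ℕtoℚ-cancel-< bound)
    where
    R : ℕ
    R = suc r
    a N M C : ℚ
    a = 1ℚ ℚ.- ε
    N = ℕtoℚ n
    M = ℕtoℚ (n ∸ 1)
    C = ℕtoℚ (choose2 n)
    order : ℕtoℚ (suc j * R) < a ℚ.* N
    order = pathOrder-bound n r (suc j) ε<1 ⌈q⌉≡
    aN≤N : a ℚ.* N ≤ N
    aN≤N = subst (a ℚ.* N ≤_) (ℚ.*-identityˡ N)
                 (ℚ.*-monoʳ-≤-nonNeg N {{ℚ.normalize-nonNeg n 1}} (1-ε≤1 0<ε))
    j+1<n : suc j ℕ.< n
    j+1<n = ℕ.≤-<-trans (ℕ.m≤m*n (suc j) R) (ℕtoℚ-cancel-< (ℚ.<-≤-trans order aN≤N))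
    M-pos : ℚ.Positive M
    M-pos = ℚ.normalize-pos (n ∸ 1) 1 {{_}} {{ℕ.>-nonZero (ℕ.<-≤-trans (s≤s z≤n) (ℕ.∸-monoˡ-≤ 1 j+1<n))}}
    bound : ℕtoℚ (suc j * R * (n ∸ 1)) < ℕtoℚ (E + E)
    bound = begin-strict
      ℕtoℚ (suc j * R * (n ∸ 1))         ≡⟨ ℕtoℚ-homo-* (suc j * R) (n ∸ 1) ⟩
      ℕtoℚ (suc j * R) ℚ.* M             <⟨ ℚ.*-monoˡ-<-pos M {{M-pos}} order ⟩
      a ℚ.* N ℚ.* M                      ≡⟨ ℚ.*-assoc a N M ⟩
      a ℚ.* (N ℚ.* M)                    ≡⟨ cong (a ℚ.*_) (ℕtoℚ-homo-* n (n ∸ 1)) ⟨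
      a ℚ.* ℕtoℚ (n * (n ∸ 1))           ≡⟨ cong (λ m → a ℚ.* ℕtoℚ m) (choose2-double n) ⟨
      a ℚ.* ℕtoℚ (choose2 n + choose2 n) ≡⟨ cong (a ℚ.*_) (ℕtoℚ-homo-+ (choose2 n) (choose2 n)) ⟩
      a ℚ.* (C ℚ.+ C)                    ≡⟨ ℚ.*-distribˡ-+ a C C ⟩
      a ℚ.* C ℚ.+ a ℚ.* C                ≤⟨ ℚ.+-mono-≤ dense dense ⟩
      ℕtoℚ E ℚ.+ ℕtoℚ E                  ≡⟨ ℕtoℚ-homo-+ E E ⟨
      ℕtoℚ (E + E)                       ∎
      where open ℚ.≤-Reasoning

  pathOrder-empty : ∀ ε r → pathOrder ε 0 r ≡ 0
  pathOrder-empty ε r =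
    cong (λ q → ℤ.∣ ceiling q ∣) (trans (cong (ℚ._* inv r) (ℚ.*-zeroʳ (1ℚ ℚ.- ε))) (ℚ.*-zeroˡ (inv r)))

  pathOrder-suc⇒nonempty : ∀ {ε r k} n → pathOrder ε n r ≡ suc k → 0 ℕ.< n
  pathOrder-suc⇒nonempty {ε} {r} zero ⌈q⌉≡ with () ← trans (sym (pathOrder-empty ε r)) ⌈q⌉≡
  pathOrder-suc⇒nonempty (suc n) _ = s≤s z≤n

open import Defs
open import Data.Nat using (ℕ; _≤_)
open import Data.Rational using (ℚ; _<_; _*_; _-_; 0ℚ; 1ℚ) renaming (_≤_ to _≤ℚ_)
open import Data.Empty using (⊥-elim)
open import Data.Fin using (zero; fromℕ<)
open import Data.List using ([]; [_])
open import Data.List.Relation.Unary.All using ([]; _∷_)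
open import Data.List.Relation.Unary.Unique.Propositional using ([]; _∷_)
open import Data.Nat using (suc)
open import Data.Nat.Properties using (<⇒≱)
open import Data.Product using (_,_)
open import Data.Sum using (inj₁; inj₂)
open import Data.Unit using (tt)
open Colourings
open Arithmetic

corollary4p3 : (r : ℕ) → 3 ≤ r → (ε : ℚ) → 0ℚ < ε → ε < 1ℚ →
    (n : ℕ) (G : Graph n) →
    (1ℚ - ε) * ℕtoℚ (choose2 n) ≤ℚ ℕtoℚ (edgeCount G) →
    G ⟶P[ pathOrder ε n r ] r
corollary4p3 (suc r) _ ε 0<ε ε<1 n G dense c with pathOrder ε n (suc r) in k≡
... | 0           = monoPath c zero [] ([] , [] , tt)
... | 1           = monoPath c zero [ fromℕ< (pathOrder-suc⇒nonempty {ε} {suc r} n k≡) ] (tt ∷ [] , [] ∷ [] , tt)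
... | suc (suc j) with monoPath-or-sparse c j
...   | inj₁ path   = path
...   | inj₂ sparse = ⊥-elim (<⇒≱ (dense⇒many-edges {ε} {edgeCount G} n r j 0<ε ε<1 dense k≡) sparse)
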